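{- Let $G$ be a 2-connected gem-induced-minor-free graph. Suppose $C\subseteq V(G)$ induces a 2-connected subgraph of $G$ and $M$ is the vertex set of a connected component of $G-C$ with $N(M)\cap C\neq C$ and $|N(M)\cap C|\le 3$. If there is no vertex $x\in M$ with $|N(x)\cap C|=1$, then every vertex of $M$ has a neighbour in $C$, and $G[M]$ is $P_4$-free.
   Context: Graphs are finite and simple. A graph is 2-connected if it is connected, has at least three vertices, and stays connected after deleting any single vertex. $N(v)$ is the neighbourhood of $v$; for $M\subseteq V(G)$, $N(M)$ is the set of vertices outside $M$ with a neighbour in $M$. $G[M]$ is the induced subgraph. The gem is a 4-vertex path plus a vertex adjacent to all four; gem-induced-minor-free means no graph isomorphic to the gem arises from $G$ by vertex deletions and edge contractions. $P_4$-free means no induced subgraph isomorphic to the path on four vertices. -}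

module Defs where

open import Data.Nat using (ℕ; zero; suc; _≤_)
open import Data.Bool using (Bool; true; false; _∧_; _∨_; not; if_then_else_)
open import Data.Bool.Properties using (∨-comm; ∨-assoc)
open import Data.Fin using (Fin; zero; suc; punchIn; _≟_)
open import Data.Fin.Properties using (any?)
open import Data.Fin.Subset using (Subset; _∈_; _∉_; _∩_; _-_; ∣_∣)
open import Data.Fin.Subset.Properties using (_∈?_)
open import Data.Vec using (tabulate)
open import Data.Product using (Σ; ∃; ∃-syntax; _×_; _,_)
open import Function.Bundles using (_↔_; Inverse)
open import Relation.Nullary using (¬_; yes; no)
open import Relation.Nullary.Decidable using (⌊_⌋; _×-dec_)
open import Relation.Binary.PropositionalEquality using (_≡_; _≢_; refl; sym; trans; cong)

record Graph (n : ℕ) : Set where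
  field
    adj    : Fin n → Fin n → Bool
    adj-sym    : ∀ i j → adj i j ≡ adj j i
    adj-irrefl : ∀ i → adj i i ≡ false
open Graph public

Edge : ∀ {n} → Graph n → Fin n → Fin n → Set
Edge G i j = adj G i j ≡ true

_≅_ : ∀ {m n} → Graph m → Graph n → Set
_≅_ {m} {n} H G =
  Σ (Fin m ↔ Fin n) λ f →
    ∀ i j → adj H i j ≡ adj G (Inverse.to f i) (Inverse.to f j)

-- Vertex deletion: G - v, vertices of G - v are Fin n, vertex i of
-- G - v being vertex punchIn v i of G.

deleteVertex : ∀ {n} → Graph (suc n) → Fin (suc n) → Graph n
deleteVertex G v = record
  { adj        = λ i j → adj G (punchIn v i) (punchIn v j)
  ; adj-sym    = λ i j → adj-sym G (punchIn v i) (punchIn v j)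
  ; adj-irrefl = λ i → adj-irrefl G (punchIn v i)
  }

-- Edge contraction: contract G v u merges vertex v into vertex
-- punchIn v u (used only when they are adjacent).  The merged vertex
-- is u in the new graph; it is adjacent to every vertex adjacent
-- (in G) to punchIn v u or to v; no loops are created.

private
  eqb : ∀ {n} → Fin n → Fin n → Bool
  eqb i j = ⌊ i ≟ j ⌋

  eqb-sym : ∀ {n} (i j : Fin n) → eqb i j ≡ eqb j i
  eqb-sym i j with i ≟ j | j ≟ i
  ... | yes _ | yes _ = refl
  ... | no _  | no _  = refl
  ... | yes p | no q  = Data.Empty.⊥-elim (q (sym p))
    where import Data.Empty
  ... | no q  | yes p = Data.Empty.⊥-elim (q (sym p))
    where import Data.Empty

  eqb-refl : ∀ {n} (i : Fin n) → eqb i i ≡ true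
  eqb-refl i with i ≟ i
  ... | yes _ = refl
  ... | no q  = Data.Empty.⊥-elim (q refl)
    where import Data.Empty

contractEdge : ∀ {n} → Graph (suc n) → (v : Fin (suc n)) → Fin n → Graph n
contractEdge {n} G v u = record
  { adj        = A
  ; adj-sym    = A-sym
  ; adj-irrefl = λ i → cong (λ b → not b ∧ R i i) (eqb-refl i)
  }
  where
  p : Fin n → Fin (suc n)
  p = punchIn v
  R : Fin n → Fin n → Bool
  R i j = adj G (p i) (p j) ∨ ((eqb i u ∧ adj G v (p j)) ∨ (eqb j u ∧ adj G v (p i)))
  A : Fin n → Fin n → Bool
  A i j = not (eqb i j) ∧ R i j
  R-sym : ∀ i j → R i j ≡ R j i
  R-sym i j
    rewrite adj-sym G (p i) (p j)
          | ∨-comm (eqb i u ∧ adj G v (p j)) (eqb j u ∧ adj G v (p i)) = refl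
  A-sym : ∀ i j → A i j ≡ A j i
  A-sym i j rewrite eqb-sym i j | R-sym i j = refl

data _≼_ {m : ℕ} (H : Graph m) : ∀ {n} → Graph n → Set where
  iso      : ∀ {n} {G : Graph n} → H ≅ G → H ≼ G
  delete   : ∀ {n} {G : Graph (suc n)} (v : Fin (suc n)) →
             H ≼ deleteVertex G v → H ≼ G
  contract : ∀ {n} {G : Graph (suc n)} (v : Fin (suc n)) (u : Fin n) →
             Edge G v (punchIn v u) → H ≼ contractEdge G v u → H ≼ G

-- The gem: path 0-1-2-3 plus vertex 4 adjacent to all of 0,1,2,3.

gemAdj : Fin 5 → Fin 5 → Bool
gemAdj zero (suc zero) = true
gemAdj (suc zero) zero = true
gemAdj (suc zero) (suc (suc zero)) = true
gemAdj (suc (suc zero)) (suc zero) = true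
gemAdj (suc (suc zero)) (suc (suc (suc zero))) = true
gemAdj (suc (suc (suc zero))) (suc (suc zero)) = true
gemAdj (suc (suc (suc (suc zero)))) (suc (suc (suc (suc zero)))) = false
gemAdj (suc (suc (suc (suc zero)))) _ = true
gemAdj _ (suc (suc (suc (suc zero)))) = true
gemAdj _ _ = false

private
  all5 : ∀ {P : Fin 5 → Set} → P zero → P (suc zero) → P (suc (suc zero)) →
         P (suc (suc (suc zero))) → P (suc (suc (suc (suc zero)))) → ∀ i → P i
  all5 a b c d e zero = a
  all5 a b c d e (suc zero) = b
  all5 a b c d e (suc (suc zero)) = c
  all5 a b c d e (suc (suc (suc zero))) = d
  all5 a b c d e (suc (suc (suc (suc zero)))) = e

  gemSym : ∀ i j → gemAdj i j ≡ gemAdj j i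
  gemSym = all5 (all5 refl refl refl refl refl) (all5 refl refl refl refl refl)
                (all5 refl refl refl refl refl) (all5 refl refl refl refl refl)
                (all5 refl refl refl refl refl)

gem : Graph 5
gem = record
  { adj = gemAdj
  ; adj-sym = gemSym
  ; adj-irrefl = all5 refl refl refl refl refl
  }

GemInducedMinorFree : ∀ {n} → Graph n → Set
GemInducedMinorFree G = ¬ (gem ≼ G)

data PathIn {n} (G : Graph n) (S : Subset n) : Fin n → Fin n → Set where
  here : ∀ {u} → u ∈ S → PathIn G S u u
  step : ∀ {u w v} → u ∈ S → Edge G u w → PathIn G S w v → PathIn G S u v

ConnectedIn : ∀ {n} → Graph n → Subset n → Set
ConnectedIn G S = (∃[ u ] u ∈ S) × (∀ u v → u ∈ S → v ∈ S → PathIn G S u v)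

TwoConnectedIn : ∀ {n} → Graph n → Subset n → Set
TwoConnectedIn G S =
  (3 ≤ ∣ S ∣) × ConnectedIn G S × (∀ v → v ∈ S → ConnectedIn G (S - v))

TwoConnected : ∀ {n} → Graph n → Set
TwoConnected G = TwoConnectedIn G Data.Fin.Subset.⊤

IsComponentOfMinus : ∀ {n} → Graph n → Subset n → Subset n → Set
IsComponentOfMinus G C M =
  (∀ x → x ∈ M → x ∉ C) ×
  ConnectedIn G M ×
  (∀ x y → x ∈ M → Edge G x y → y ∉ C → y ∈ M)

Nbhd : ∀ {n} → Graph n → Fin n → Subset n
Nbhd G v = tabulate (adj G v)

NbhdSet : ∀ {n} → Graph n → Subset n → Subset n
NbhdSet G M = tabulate λ w →
  not ⌊ w ∈? M ⌋ ∧ ⌊ any? (λ x → (x ∈? M) ×-dec (adj G w x Data.Bool.≟ true)) ⌋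

P4FreeIn : ∀ {n} → Graph n → Subset n → Set
P4FreeIn G M = ∀ a b c d → a ∈ M → b ∈ M → c ∈ M → d ∈ M →
  a ≢ b → a ≢ c → a ≢ d → b ≢ c → b ≢ d → c ≢ d →
  Edge G a b → Edge G b c → Edge G c d →
  adj G a c ≡ false → adj G b d ≡ false → adj G a d ≡ false → Data.Empty.⊥
  where import Data.Empty

-- A gem induced minor is exhibited by a model: five disjoint connected branch sets with the
-- adjacencies and non-adjacencies of the gem. Deleting the vertices outside the branch sets and
-- contracting the edges inside them leaves a copy of the gem.
--
-- Call a vertex of M attached if it has a neighbour in C. An attached vertex has at least two
-- (none has exactly one), all in N(M) ∩ C, which has at most three elements; so any two attached
-- vertices share a neighbour in C. If some y ∈ M were detached, a walk from y to C leaves the detached vertices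
-- through an attached x₁, and a walk in G − x₁ through an attached x₂ ≠ x₁; let a be a common
-- neighbour of x₁ and x₂ in C. An edge sw of C − a with s ∈ N(x₁) and w ∉ N(x₁), and a connected
-- part of C − s − w containing a and seeing both s and w, complete the gem with branch sets
-- (detached vertices, x₁, s, w, x₂ plus that part).
-- Hence all of M is attached. Fix two neighbours c₁, c₂ ∈ C of one vertex of M: every vertex of M
-- sees c₁ or c₂, so a c₁–c₂ path in C dominates any induced P₄ of G[M], and again G has a gem.

module Submission where

open import Defs
open import Level using (0ℓ)
open import Data.Nat using (ℕ; zero; suc; _≤_; z≤n; s≤s)
open import Data.Nat.Properties using (≤-trans; ≤⇒≯)
open import Data.Fin using (Fin; punchIn; punchOut) renaming (suc to fsuc; _≟_ to _≟ᶠ_)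
open import Data.Fin.Patterns using (0F; 1F; 2F; 3F; 4F)
open import Data.Fin.Properties using (any?; all?; punchIn-punchOut; punchInᵢ≢i; punchIn-injective)
open import Data.Fin.Subset using (Subset; _∈_; _∉_; _∩_; _⊆_; _─_; _-_; ⁅_⁆; ∣_∣; inside; outside)
open import Data.Fin.Subset.Properties using (_∈?_; ∈⊤; p∩q⊆q; x∈p∩q⁺; x∈p∩q⁻; p─q⊆p; x∈p∧x≢y⇒x∈p-y; x∈p⇒∣p-x∣<∣p∣; x∈⁅x⁆; x∈⁅y⁆⇒x≡y; x∉⁅y⁆⇒x≢y; ⊆-antisym; ∣⁅x⁆∣≡1)
open import Data.Vec using (_∷_; tabulate; there)
open import Data.Vec.Properties using (lookup∘tabulate; lookup⇒[]=; []=⇒lookup)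
open import Data.Bool using (Bool; true; false; not; _∧_; _∨_)
open import Data.Bool.Properties using (∨-zeroʳ; ¬-not) renaming (_≟_ to _≟ᵇ_)
open import Data.Product using (∃-syntax; _×_; _,_; proj₁; proj₂)
open import Data.Sum using (_⊎_; inj₁; inj₂)
open import Data.Empty using (⊥; ⊥-elim)
open import Function using (_∘_)
open import Function.Bundles using (mk↔ₛ′)
open import Relation.Nullary using (¬_; Dec; yes; no)
open import Relation.Nullary.Decidable using (⌊_⌋; _⊎-dec_; _×-dec_; ¬?; decidable-stable)
open import Relation.Unary using (Pred; Decidable; _≬_)
open import Relation.Binary.PropositionalEquality using (_≡_; _≢_; refl; sym; trans; cong; subst; subst₂)

private
  variable
    n : ℕ
    G : Graph n
    P Q R : Pred (Fin n) 0ℓ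
    u v x y z : Fin n

Edge-sym : (G : Graph n) → Edge G u v → Edge G v u
Edge-sym G e = trans (adj-sym G _ _) e

Edge⇒≢ : (G : Graph n) → Edge G u v → u ≢ v
Edge⇒≢ G e refl with trans (sym (adj-irrefl G _)) e
... | ()

edge? : (G : Graph n) → ∀ u v → Dec (Edge G u v)
edge? G u v = adj G u v ≟ᵇ true

data Walk (G : Graph n) (P : Pred (Fin n) 0ℓ) : Fin n → Fin n → Set where
  [_] : P u → Walk G P u u
  step : ∀ {w} → P u → Edge G u w → Walk G P w v → Walk G P u v

head∈ : Walk G P x y → P x
head∈ [ p ] = p
head∈ (step p _ _) = p

last∈ : Walk G P x y → P y
last∈ [ p ] = p
last∈ (step _ _ r) = last∈ r

weaken : (∀ {z} → P z → Q z) → Walk G P x y → Walk G Q x y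
weaken f [ p ] = [ f p ]
weaken f (step p e r) = step (f p) e (weaken f r)

_++_ : Walk G P x y → Walk G P y z → Walk G P x z
[ _ ] ++ r′ = r′
step p e r ++ r′ = step p e (r ++ r′)

reverse : Walk G P x y → Walk G P y x
reverse [ p ] = [ p ]
reverse {G = G} (step p e r) = reverse r ++ step (head∈ r) (Edge-sym G e) [ p ]

fromPathIn : ∀ {S} → PathIn G S x y → Walk G (_∈ S) x y
fromPathIn (here p) = [ p ]
fromPathIn (step p e r) = step p e (fromPathIn r)

OnWalk : Walk G P x y → Pred (Fin _) 0ℓ
OnWalk ([_] {u} _) v = v ≡ u
OnWalk (step {u} _ _ r) v = v ≡ u ⊎ OnWalk r v

onWalk? : (r : Walk G P x y) → Decidable (OnWalk r)
onWalk? ([_] {u} _) v = v ≟ᶠ u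
onWalk? (step {u} _ _ r) v = (v ≟ᶠ u) ⊎-dec onWalk? r v

onWalk⇒P : (r : Walk G P x y) → OnWalk r v → P v
onWalk⇒P [ p ] refl = p
onWalk⇒P (step p _ _) (inj₁ refl) = p
onWalk⇒P (step _ _ r) (inj₂ o) = onWalk⇒P r o

head-onWalk : (r : Walk G P x y) → OnWalk r x
head-onWalk [ _ ] = refl
head-onWalk (step _ _ _) = inj₁ refl

last-onWalk : (r : Walk G P x y) → OnWalk r y
last-onWalk [ _ ] = refl
last-onWalk (step _ _ r) = inj₂ (last-onWalk r)

junction-onWalk : (r : Walk G P x y) (r′ : Walk G P y z) → OnWalk (r ++ r′) y
junction-onWalk [ _ ] r′ = head-onWalk r′
junction-onWalk (step _ _ r) r′ = inj₂ (junction-onWalk r r′)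

walkToLast : (r : Walk G P x y) → OnWalk r v → Walk G (OnWalk r) v y
walkToLast [ _ ] refl = [ refl ]
walkToLast (step _ e r) (inj₁ refl) = step (inj₁ refl) e (weaken inj₂ (walkToLast r (head-onWalk r)))
walkToLast (step _ _ r) (inj₂ o) = weaken inj₂ (walkToLast r o)

record Exit (G : Graph n) (P R : Pred (Fin n) 0ℓ) (x : Fin n) : Set where
  constructor mkExit
  field
    {inner outer} : Fin n
    segment : Walk G (λ z → P z × R z) x inner
    edge    : Edge G inner outer
    outer∉R : ¬ R outer
    outer∈P : P outer

exit : Decidable R → Walk G P x y → R x → ¬ R y → Exit G P R x
exit R? [ _ ] rx ¬ry = ⊥-elim (¬ry rx)
exit R? (step {w = w} p e r) rx ¬ry with R? w
... | yes rw = let mkExit s e′ ¬rt pt = exit R? r rw ¬ry in mkExit (step (p , rx) e s) e′ ¬rt pt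
... | no ¬rw = mkExit [ p , rx ] e ¬rw (head∈ r)

approach : Walk G P x y → x ≢ y → ∃[ u ] (Walk G (λ z → P z × z ≢ y) x u × Edge G u y)
approach {G = G} {y = y} r x≢y with exit (λ z → ¬? (z ≟ᶠ y)) r x≢y (λ y≢y → y≢y refl)
... | mkExit segment e ¬outer≢y _ = _ , segment , subst (Edge G _) (decidable-stable (_ ≟ᶠ y) ¬outer≢y) e

record BranchSet (G : Graph n) : Set₁ where
  field
    member    : Pred (Fin n) 0ℓ
    member?   : Decidable member
    root      : Fin n
    root∈     : member root
    connected : ∀ {v} → member v → Walk G member v root
open BranchSet public

Disjoint : (X Y : BranchSet G) → Set
Disjoint X Y = ∀ {v} → member X v → member Y v → ⊥

Touching : (X Y : BranchSet G) → Set
Touching {G = G} X Y = ∃[ u ] ∃[ v ] (member X u × member Y v × Edge G u v)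

Apart : (X Y : BranchSet G) → Set
Apart {G = G} X Y = ∀ {u v} → member X u → member Y v → ¬ Edge G u v

record Model {m} (H : Graph m) (G : Graph n) : Set₁ where
  field
    branch   : Fin m → BranchSet G
    disjoint : ∀ {i j} → i ≢ j → Disjoint (branch i) (branch j)
    touching : ∀ {i j} → Edge H i j → Touching (branch i) (branch j)
    apart    : ∀ {i j} → i ≢ j → adj H i j ≡ false → Apart (branch i) (branch j)

module Deletion (G : Graph (suc n)) (v : Fin (suc n)) where
  private
    G′ = deleteVertex G v
    ι = punchIn v

  unpunch : v ≢ x → ∃[ x′ ] ι x′ ≡ x
  unpunch v≢x = punchOut v≢x , punchIn-punchOut v≢x

  walk-unpunch : ¬ P v → Walk G P x y → ∀ {x′ y′} → ι x′ ≡ x → ι y′ ≡ y → Walk G′ (P ∘ ι) x′ y′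
  walk-unpunch ¬pv [ p ] refl eq with punchIn-injective v _ _ (sym eq)
  ... | refl = [ p ]
  walk-unpunch ¬pv (step {w = w} p e r) refl eqy with unpunch {x = w} (λ { refl → ¬pv (head∈ r) })
  ... | w′ , refl = step p e (walk-unpunch ¬pv r refl eqy)

  deleteBranchSet : (X : BranchSet G) → ¬ member X v → BranchSet G′
  deleteBranchSet X v∉X = record
    { member    = member X ∘ ι
    ; member?   = member? X ∘ ι
    ; root      = proj₁ root′
    ; root∈     = subst (member X) (sym (proj₂ root′)) (root∈ X)
    ; connected = λ p → walk-unpunch v∉X (connected X p) refl (proj₂ root′)
    }
    where
    root′ = unpunch {x = root X} λ { refl → v∉X (root∈ X) }

  deleteModel : ∀ {m} {H : Graph m} (M : Model H G) → (∀ i → ¬ member (Model.branch M i) v) → Model H G′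
  deleteModel {H = H} M v∉ = record
    { branch   = λ i → deleteBranchSet (branch i) (v∉ i)
    ; disjoint = λ i≢j → disjoint i≢j
    ; touching = touching′
    ; apart    = λ i≢j ¬ij → apart i≢j ¬ij
    }
    where
    open Model M
    touching′ : ∀ {i j} → Edge H i j → Touching (deleteBranchSet (branch i) (v∉ i)) (deleteBranchSet (branch j) (v∉ j))
    touching′ {i} {j} ij with touching ij
    ... | a , b , a∈ , b∈ , e
      with unpunch {x = a} (λ { refl → v∉ i a∈ }) | unpunch {x = b} (λ { refl → v∉ j b∈ })
    ...   | a′ , refl | b′ , refl = a′ , b′ , a∈ , b∈ , e

private
  ∨∧-true⁻ : ∀ e a b c d f → not e ∧ (a ∨ ((b ∧ c) ∨ (d ∧ f))) ≡ true →
             a ≡ true ⊎ (b ≡ true × c ≡ true) ⊎ (d ≡ true × f ≡ true)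
  ∨∧-true⁻ false true  _     _     _     _     _ = inj₁ refl
  ∨∧-true⁻ false false true  true  _     _     _ = inj₂ (inj₁ (refl , refl))
  ∨∧-true⁻ false false true  false true  true  _ = inj₂ (inj₂ (refl , refl))
  ∨∧-true⁻ false false false _     true  true  _ = inj₂ (inj₂ (refl , refl))
  ∨∧-true⁻ false false true  false true  false ()
  ∨∧-true⁻ false false true  false false _     ()
  ∨∧-true⁻ false false false _     true  false ()
  ∨∧-true⁻ false false false _     false _     ()
  ∨∧-true⁻ true  _     _     _     _     _     ()

  ⌊⌋-true⁻ : ∀ {A : Set} (a? : Dec A) → ⌊ a? ⌋ ≡ true → A
  ⌊⌋-true⁻ (yes a) _ = a

module Contraction (G : Graph (suc n)) (v : Fin (suc n)) (u : Fin n) where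
  private
    G′ = contractEdge G v u
    ι = punchIn v

  -- The quotient map of the contraction: v is identified with ι u.
  squash : Fin (suc n) → Fin n
  squash x with v ≟ᶠ x
  ... | yes _ = u
  ... | no v≢x = punchOut v≢x

  squash-v : squash v ≡ u
  squash-v with v ≟ᶠ v
  ... | yes _ = refl
  ... | no v≢v = ⊥-elim (v≢v refl)

  punchIn-squash : x ≢ v → ι (squash x) ≡ x
  punchIn-squash {x = x} x≢v with v ≟ᶠ x
  ... | yes refl = ⊥-elim (x≢v refl)
  ... | no v≢x = punchIn-punchOut v≢x

  squash-punchIn : ∀ z → squash (ι z) ≡ z
  squash-punchIn z = punchIn-injective v _ _ (punchIn-squash (punchInᵢ≢i v z))

  edge-kept : ∀ {a b} → a ≢ b → Edge G (ι a) (ι b) → Edge G′ a b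
  edge-kept {a} {b} a≢b e rewrite e with a ≟ᶠ b
  ... | yes a≡b = ⊥-elim (a≢b a≡b)
  ... | no _ = refl

  edge-merged : ∀ {a} → a ≢ u → Edge G v (ι a) → Edge G′ u a
  edge-merged {a} a≢u e rewrite e with u ≟ᶠ a | u ≟ᶠ u
  ... | yes u≡a | _ = ⊥-elim (a≢u (sym u≡a))
  ... | no _ | yes _ = ∨-zeroʳ (adj G (ι u) (ι a))
  ... | no _ | no u≢u = ⊥-elim (u≢u refl)

  edge-origin : ∀ {a b} → Edge G′ a b →
    Edge G (ι a) (ι b) ⊎ (a ≡ u × Edge G v (ι b)) ⊎ (b ≡ u × Edge G v (ι a))
  edge-origin {a} {b} e with ∨∧-true⁻ _ _ _ _ _ _ e
  ... | inj₁ e′ = inj₁ e′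
  ... | inj₂ (inj₁ (a≡u , e′)) = inj₂ (inj₁ (⌊⌋-true⁻ (a ≟ᶠ u) a≡u , e′))
  ... | inj₂ (inj₂ (b≡u , e′)) = inj₂ (inj₂ (⌊⌋-true⁻ (b ≟ᶠ u) b≡u , e′))

  edge-squash : Edge G x y → squash x ≢ squash y → Edge G′ (squash x) (squash y)
  edge-squash {x} {y} e ne with x ≟ᶠ v | y ≟ᶠ v
  ... | yes refl | yes refl = ⊥-elim (Edge⇒≢ G e refl)
  ... | yes refl | no y≢v = subst (λ q → Edge G′ q (squash y)) (sym squash-v)
    (edge-merged (λ eq → ne (trans squash-v (sym eq))) (subst (Edge G v) (sym (punchIn-squash y≢v)) e))
  ... | no x≢v | yes refl = Edge-sym G′ (subst (λ q → Edge G′ q (squash x)) (sym squash-v)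
    (edge-merged (λ eq → ne (trans eq (sym squash-v))) (subst (Edge G v) (sym (punchIn-squash x≢v)) (Edge-sym G e))))
  ... | no x≢v | no y≢v =
    edge-kept ne (subst₂ (Edge G) (sym (punchIn-squash x≢v)) (sym (punchIn-squash y≢v)) e)

  walk-squash : (∀ {x} → P x → P (ι (squash x))) → Walk G P x y → Walk G′ (P ∘ ι) (squash x) (squash y)
  walk-squash close [ p ] = [ close p ]
  walk-squash close (step {u = x} {w = w} p e r) with squash x ≟ᶠ squash w
  ... | yes eq = subst (λ q → Walk G′ _ q _) (sym eq) (walk-squash close r)
  ... | no ne = step (close p) (edge-squash e ne) (walk-squash close r)

  module _ {m} {H : Graph m} (M : Model H G) {k : Fin m}
           (v∈k : member (Model.branch M k) v) (u∈k : member (Model.branch M k) (ι u)) where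
    open Model M

    squash-closed : ∀ i {x} → member (branch i) x → member (branch i) (ι (squash x))
    squash-closed i {x} x∈ with x ≟ᶠ v
    ... | no x≢v = subst (member (branch i)) (sym (punchIn-squash x≢v)) x∈
    ... | yes refl with i ≟ᶠ k
    ...   | yes refl = subst (member (branch i) ∘ ι) (sym squash-v) u∈k
    ...   | no i≢k = ⊥-elim (disjoint i≢k x∈ v∈k)

    contractBranchSet : Fin m → BranchSet G′
    contractBranchSet i = record
      { member    = member (branch i) ∘ ι
      ; member?   = member? (branch i) ∘ ι
      ; root      = squash (root (branch i))
      ; root∈     = squash-closed i (root∈ (branch i))
      ; connected = λ {z} p → subst (λ q → Walk G′ _ q _) (squash-punchIn z)
                                    (walk-squash (squash-closed i) (connected (branch i) p))
      }

    merged-in-k : ∀ {i} → member (branch i) (ι u) → i ≢ k → ⊥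
    merged-in-k u∈i i≢k = disjoint i≢k u∈i u∈k

    contractModel : Model H G′
    contractModel = record
      { branch   = contractBranchSet
      ; disjoint = λ i≢j → disjoint i≢j
      ; touching = touching′
      ; apart    = apart′
      }
      where
      touching′ : ∀ {i j} → Edge H i j → Touching (contractBranchSet i) (contractBranchSet j)
      touching′ {i} {j} ij with touching ij
      ... | a , b , a∈ , b∈ , e = squash a , squash b , squash-closed i a∈ , squash-closed j b∈ , edge-squash e a≁b
        where
        a≁b : squash a ≢ squash b
        a≁b eq with i ≟ᶠ j
        ... | yes i≡j = Edge⇒≢ H ij i≡j
        ... | no i≢j = disjoint i≢j (squash-closed i a∈) (subst (member (branch j) ∘ ι) (sym eq) (squash-closed j b∈))

      apart′ : ∀ {i j} → i ≢ j → adj H i j ≡ false → Apart (contractBranchSet i) (contractBranchSet j)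
      apart′ {i} {j} i≢j ¬ij a∈ b∈ e with edge-origin e
      ... | inj₁ e′ = apart i≢j ¬ij a∈ b∈ e′
      ... | inj₂ (inj₁ (refl , e′)) with i ≟ᶠ k
      ...   | yes refl = apart i≢j ¬ij v∈k b∈ e′
      ...   | no i≢k = merged-in-k a∈ i≢k
      apart′ {i} {j} i≢j ¬ij a∈ b∈ e | inj₂ (inj₂ (refl , e′)) with j ≟ᶠ k
      ...   | yes refl = apart i≢j ¬ij a∈ v∈k (Edge-sym G e′)
      ...   | no j≢k = merged-in-k b∈ j≢k

module _ {m} {H : Graph m} (M : Model H G) where
  open Model M

  -- Without internal edges the connected branch sets are the singletons {root}.
  model⇒≅ : (∀ v → ∃[ i ] member (branch i) v) →
            (∀ {i u v} → member (branch i) u → member (branch i) v → ¬ Edge G u v) → H ≅ G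
  model⇒≅ cover spanless = mk↔ₛ′ (root ∘ branch) (proj₁ ∘ cover) root∘cover cover∘root , adj-root
    where
    only-root : ∀ {i x} → member (branch i) x → x ≡ root (branch i)
    only-root {i} x∈ with connected (branch i) x∈
    ... | [ _ ] = refl
    ... | step p e r = ⊥-elim (spanless p (head∈ r) e)

    root∘cover : ∀ x → root (branch (proj₁ (cover x))) ≡ x
    root∘cover x = sym (only-root (proj₂ (cover x)))

    cover∘root : ∀ i → proj₁ (cover (root (branch i))) ≡ i
    cover∘root i with proj₁ (cover (root (branch i))) ≟ᶠ i
    ... | yes eq = eq
    ... | no ne = ⊥-elim (disjoint ne (proj₂ (cover (root (branch i)))) (root∈ (branch i)))

    adj-root : ∀ i j → adj H i j ≡ adj G (root (branch i)) (root (branch j))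
    adj-root i j with adj H i j in ij
    ... | true with touching ij
    ...   | a , b , a∈ , b∈ , e rewrite only-root a∈ | only-root b∈ = sym e
    adj-root i j | false with i ≟ᶠ j
    ...   | yes refl = sym (adj-irrefl G (root (branch i)))
    ...   | no i≢j = sym (¬-not (apart i≢j ij (root∈ (branch i)) (root∈ (branch j))))

model⇒≼ : ∀ {n} {G : Graph n} {m} {H : Graph m} → Model H G → H ≼ G
model⇒≼ {n = zero} M = iso (model⇒≅ M (λ ()) λ { {u = ()} })
model⇒≼ {n = suc n} {G = G} {H = H} M = reduce
  (any? λ v → all? λ i → ¬? (member? (branch i) v))
  (any? λ v → any? λ u → edge? G v (punchIn v u) ×-dec
                         any? λ k → member? (branch k) v ×-dec member? (branch k) (punchIn v u))
  where
  open Model M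
  Unused : Pred (Fin (suc n)) 0ℓ
  Unused v = ∀ i → ¬ member (branch i) v
  InternalEdge : Fin (suc n) → Fin n → Set
  InternalEdge v u = Edge G v (punchIn v u) × ∃[ k ] (member (branch k) v × member (branch k) (punchIn v u))

  reduce : Dec (∃[ v ] Unused v) → Dec (∃[ v ] ∃[ u ] InternalEdge v u) → H ≼ G
  reduce (yes (v , v∉)) _ = delete v (model⇒≼ (Deletion.deleteModel G v M v∉))
  reduce (no _) (yes (v , u , e , _ , v∈ , u∈)) = contract v u e (model⇒≼ (Contraction.contractModel G v u M v∈ u∈))
  reduce (no ¬unused) (no ¬internal) = iso (model⇒≅ M cover spanless)
    where
    cover : ∀ v → ∃[ i ] member (branch i) v
    cover v with any? (λ i → member? (branch i) v)
    ... | yes c = c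
    ... | no ¬c = ⊥-elim (¬unused (v , λ i v∈ → ¬c (i , v∈)))
    spanless : ∀ {i x y} → member (branch i) x → member (branch i) y → ¬ Edge G x y
    spanless {i} {x} x∈ y∈ e = ¬internal (x , punchOut x≢y , e′ , i , x∈ , y∈′)
      where
      x≢y = Edge⇒≢ G e
      e′ = subst (Edge G x) (sym (punchIn-punchOut x≢y)) e
      y∈′ = subst (member (branch i)) (sym (punchIn-punchOut x≢y)) y∈

module _ {R : Fin 5 → Fin 5 → Set} (R-sym : ∀ {i j} → R i j → R j i) where
  distinctPairs : R 0F 1F → R 0F 2F → R 0F 3F → R 0F 4F → R 1F 2F → R 1F 3F → R 1F 4F →
                  R 2F 3F → R 2F 4F → R 3F 4F → ∀ {i j} → i ≢ j → R i j
  distinctPairs r01 r02 r03 r04 r12 r13 r14 r23 r24 r34 = pairs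
    where
    pairs : ∀ {i j} → i ≢ j → R i j
    pairs {0F} {0F} ne = ⊥-elim (ne refl)
    pairs {0F} {1F} _ = r01
    pairs {0F} {2F} _ = r02
    pairs {0F} {3F} _ = r03
    pairs {0F} {4F} _ = r04
    pairs {1F} {1F} ne = ⊥-elim (ne refl)
    pairs {1F} {2F} _ = r12
    pairs {1F} {3F} _ = r13
    pairs {1F} {4F} _ = r14
    pairs {2F} {2F} ne = ⊥-elim (ne refl)
    pairs {2F} {3F} _ = r23
    pairs {2F} {4F} _ = r24
    pairs {3F} {3F} ne = ⊥-elim (ne refl)
    pairs {3F} {4F} _ = r34
    pairs {4F} {4F} ne = ⊥-elim (ne refl)
    pairs {1F} {0F} _ = R-sym r01
    pairs {2F} {0F} _ = R-sym r02
    pairs {3F} {0F} _ = R-sym r03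
    pairs {4F} {0F} _ = R-sym r04
    pairs {2F} {1F} _ = R-sym r12
    pairs {3F} {1F} _ = R-sym r13
    pairs {4F} {1F} _ = R-sym r14
    pairs {3F} {2F} _ = R-sym r23
    pairs {4F} {2F} _ = R-sym r24
    pairs {4F} {3F} _ = R-sym r34

-- Branch sets X₀ X₁ X₂ X₃ model the path of the gem and X₄ its dominating vertex.
record GemModel (G : Graph n) : Set₁ where
  field
    X₀ X₁ X₂ X₃ X₄ : BranchSet G
    disj₀₁ : Disjoint X₀ X₁
    disj₀₂ : Disjoint X₀ X₂
    disj₀₃ : Disjoint X₀ X₃
    disj₀₄ : Disjoint X₀ X₄
    disj₁₂ : Disjoint X₁ X₂
    disj₁₃ : Disjoint X₁ X₃
    disj₁₄ : Disjoint X₁ X₄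
    disj₂₃ : Disjoint X₂ X₃
    disj₂₄ : Disjoint X₂ X₄
    disj₃₄ : Disjoint X₃ X₄
    touch₀₁ : Touching X₀ X₁
    touch₁₂ : Touching X₁ X₂
    touch₂₃ : Touching X₂ X₃
    touch₀₄ : Touching X₀ X₄
    touch₁₄ : Touching X₁ X₄
    touch₂₄ : Touching X₂ X₄
    touch₃₄ : Touching X₃ X₄
    apart₀₂ : Apart X₀ X₂
    apart₀₃ : Apart X₀ X₃
    apart₁₃ : Apart X₁ X₃

gemModel⇒≼ : GemModel G → gem ≼ G
gemModel⇒≼ {G = G} M = model⇒≼ record
  { branch   = X
  ; disjoint = distinctPairs {λ i j → Disjoint (X i) (X j)} (λ d p q → d q p)
                 disj₀₁ disj₀₂ disj₀₃ disj₀₄ disj₁₂ disj₁₃ disj₁₄ disj₂₃ disj₂₄ disj₃₄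
  ; touching = λ ij → distinctPairs {λ i j → Edge gem i j → Touching (X i) (X j)} touching-sym
                 (λ _ → touch₀₁) (λ ()) (λ ()) (λ _ → touch₀₄) (λ _ → touch₁₂) (λ ())
                 (λ _ → touch₁₄) (λ _ → touch₂₃) (λ _ → touch₂₄) (λ _ → touch₃₄) (Edge⇒≢ gem ij) ij
  ; apart    = distinctPairs {λ i j → adj gem i j ≡ false → Apart (X i) (X j)} apart-sym
                 (λ ()) (λ _ → apart₀₂) (λ _ → apart₀₃) (λ ()) (λ ()) (λ _ → apart₁₃)
                 (λ ()) (λ ()) (λ ()) (λ ())
  }
  where
  open GemModel M
  X : Fin 5 → BranchSet G
  X 0F = X₀
  X 1F = X₁
  X 2F = X₂
  X 3F = X₃
  X 4F = X₄
  touching-sym : ∀ {i j} → (Edge gem i j → Touching (X i) (X j)) → Edge gem j i → Touching (X j) (X i)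
  touching-sym {i} {j} t ji with t (trans (adj-sym gem i j) ji)
  ... | a , b , a∈ , b∈ , e = b , a , b∈ , a∈ , Edge-sym G e
  apart-sym : ∀ {i j} → (adj gem i j ≡ false → Apart (X i) (X j)) → adj gem j i ≡ false → Apart (X j) (X i)
  apart-sym {i} {j} a ¬ji p q e = a (trans (adj-sym gem i j) ¬ji) q p (Edge-sym G e)

singleton : {G : Graph n} → Fin n → BranchSet G
singleton x = record
  { member = _≡ x ; member? = _≟ᶠ x ; root = x ; root∈ = refl ; connected = λ { refl → [ refl ] } }

singleton-disjoint : ∀ {G : Graph n} → x ≢ y → Disjoint (singleton {G = G} x) (singleton y)
singleton-disjoint x≢y refl refl = x≢y refl

singleton-touching : ∀ {G : Graph n} → Edge G x y → Touching (singleton {G = G} x) (singleton y)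
singleton-touching e = _ , _ , refl , refl , e

singleton-apart : ∀ {G : Graph n} → adj G x y ≡ false → Apart (singleton {G = G} x) (singleton y)
singleton-apart ¬e refl refl e with trans (sym e) ¬e
... | ()

walkSet : Walk G P x y → BranchSet G
walkSet {y = y} r = record
  { member = OnWalk r ; member? = onWalk? r ; root = y ; root∈ = last-onWalk r ; connected = walkToLast r }

adjoin : (X : BranchSet G) → Edge G x v → member X v → BranchSet G
adjoin {x = x} X e v∈X = record
  { member    = λ z → z ≡ x ⊎ member X z
  ; member?   = λ z → (z ≟ᶠ x) ⊎-dec member? X z
  ; root      = root X
  ; root∈     = inj₂ (root∈ X)
  ; connected = λ { (inj₁ refl) → step (inj₁ refl) e (weaken inj₂ (connected X v∈X))
                  ; (inj₂ z∈X) → weaken inj₂ (connected X z∈X) }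
  }

∈-tabulate⁺ : ∀ (f : Fin n → Bool) → f x ≡ true → x ∈ tabulate f
∈-tabulate⁺ {x = x} f fx = lookup⇒[]= x (tabulate f) (trans (lookup∘tabulate f x) fx)

∈-tabulate⁻ : ∀ (f : Fin n → Bool) → x ∈ tabulate f → f x ≡ true
∈-tabulate⁻ {x = x} f x∈ = trans (sym (lookup∘tabulate f x)) ([]=⇒lookup x∈)

x∈p─q⇒x∉q : ∀ (p q : Subset n) {x} → x ∈ p ─ q → x ∉ q
x∈p─q⇒x∉q (_ ∷ p) (inside ∷ q) {0F} () _
x∈p─q⇒x∉q (_ ∷ p) (outside ∷ q) {0F} _ ()
x∈p─q⇒x∉q (_ ∷ p) (_ ∷ q) {fsuc x} (there x∈) (there x∈q) = x∈p─q⇒x∉q p q x∈ x∈q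

x∈p-y⁻ : ∀ {p : Subset n} {x y} → x ∈ p - y → x ∈ p × x ≢ y
x∈p-y⁻ {p = p} {y = y} x∈ = p─q⊆p p ⁅ y ⁆ x∈ , x∉⁅y⁆⇒x≢y (x∈p─q⇒x∉q p ⁅ y ⁆ x∈)

∣p∣≢1⇒another : ∀ {p : Subset n} {x} → x ∈ p → ∣ p ∣ ≢ 1 → ∃[ y ] (y ∈ p × y ≢ x)
∣p∣≢1⇒another {p = p} {x} x∈p ∣p∣≢1 with any? (λ y → (y ∈? p) ×-dec ¬? (y ≟ᶠ x))
... | yes another = another
... | no none = ⊥-elim (∣p∣≢1 (trans (cong ∣_∣ p≡⁅x⁆) (∣⁅x⁆∣≡1 x)))
  where
  p⊆⁅x⁆ : p ⊆ ⁅ x ⁆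
  p⊆⁅x⁆ {y} y∈p with y ≟ᶠ x
  ... | yes refl = x∈⁅x⁆ x
  ... | no y≢x = ⊥-elim (none (y , y∈p , y≢x))
  p≡⁅x⁆ : p ≡ ⁅ x ⁆
  p≡⁅x⁆ = ⊆-antisym p⊆⁅x⁆ λ y∈⁅x⁆ → subst (_∈ p) (sym (x∈⁅y⁆⇒x≡y x y∈⁅x⁆)) x∈p

4≤∣p∣ : ∀ {p : Subset n} {a b c d} → a ∈ p → b ∈ p → c ∈ p → d ∈ p →
        a ≢ b → a ≢ c → a ≢ d → b ≢ c → b ≢ d → c ≢ d → 4 ≤ ∣ p ∣
4≤∣p∣ a∈ b∈ c∈ d∈ a≢b a≢c a≢d b≢c b≢d c≢d =
  drop a∈ (drop (minus b∈ a≢b) (drop (minus (minus c∈ a≢c) b≢c) (drop (minus (minus (minus d∈ a≢d) b≢d) c≢d) z≤n)))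
  where
  minus : ∀ {q : Subset _} {x y} → x ∈ q → y ≢ x → x ∈ q - y
  minus x∈ y≢x = x∈p∧x≢y⇒x∈p-y x∈ (y≢x ∘ sym)
  drop : ∀ {q : Subset _} {x k} → x ∈ q → k ≤ ∣ q - x ∣ → suc k ≤ ∣ q ∣
  drop x∈ k≤ = ≤-trans (s≤s k≤) (x∈p⇒∣p-x∣<∣p∣ x∈)

DistinctPair : Pred (Fin n) 0ℓ → Set
DistinctPair P = ∃[ a ] ∃[ b ] (a ≢ b × P a × P b)

pairs-meet : ∀ {p : Subset n} → ∣ p ∣ ≤ 3 → (∀ {x} → P x → x ∈ p) → (∀ {x} → Q x → x ∈ p) →
             DistinctPair P → DistinctPair Q → P ≬ Q
pairs-meet ∣p∣≤3 P⊆p Q⊆p (a , b , a≢b , Pa , Pb) (c , d , c≢d , Qc , Qd)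
  with a ≟ᶠ c | a ≟ᶠ d | b ≟ᶠ c | b ≟ᶠ d
... | yes refl | _ | _ | _ = a , Pa , Qc
... | no _ | yes refl | _ | _ = a , Pa , Qd
... | no _ | no _ | yes refl | _ = b , Pb , Qc
... | no _ | no _ | no _ | yes refl = b , Pb , Qd
... | no a≢c | no a≢d | no b≢c | no b≢d =
  ⊥-elim (≤⇒≯ ∣p∣≤3 (4≤∣p∣ (P⊆p Pa) (P⊆p Pb) (Q⊆p Qc) (Q⊆p Qd) a≢b a≢c a≢d b≢c b≢d c≢d))

avoiding : DistinctPair P → ∀ a → ∃[ b ] (P b × b ≢ a)
avoiding (b , c , b≢c , Pb , Pc) a with b ≟ᶠ a
... | yes refl = c , Pc , b≢c ∘ sym
... | no b≢a = b , Pb , b≢a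

⊆∧≢⇒∃∉ : ∀ {p q : Subset n} → p ⊆ q → p ≢ q → ∃[ x ] (x ∈ q × x ∉ p)
⊆∧≢⇒∃∉ {p = p} {q} p⊆q p≢q with any? (λ x → (x ∈? q) ×-dec ¬? (x ∈? p))
... | yes found = found
... | no none = ⊥-elim (p≢q (⊆-antisym p⊆q q⊆p))
  where
  q⊆p : q ⊆ p
  q⊆p {x} x∈q = decidable-stable (x ∈? p) (λ x∉p → none (x , x∈q , x∉p))

∈Nbhd⁺ : ∀ {G : Graph n} {x y} → Edge G x y → y ∈ Nbhd G x
∈Nbhd⁺ {G = G} = ∈-tabulate⁺ (adj G _)

∈Nbhd⁻ : ∀ {G : Graph n} {x y} → y ∈ Nbhd G x → Edge G x y
∈Nbhd⁻ {G = G} = ∈-tabulate⁻ (adj G _)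

∈NbhdSet⁺ : ∀ {G : Graph n} {M x z} → x ∈ M → z ∉ M → Edge G z x → z ∈ NbhdSet G M
∈NbhdSet⁺ {G = G} {M} {x} {z} x∈M z∉M e = ∈-tabulate⁺ _ z∼M
  where
  z∼M : not ⌊ z ∈? M ⌋ ∧ ⌊ any? (λ x → (x ∈? M) ×-dec (adj G z x ≟ᵇ true)) ⌋ ≡ true
  z∼M with z ∈? M | any? (λ x → (x ∈? M) ×-dec (adj G z x ≟ᵇ true))
  ... | yes z∈M | _ = ⊥-elim (z∉M z∈M)
  ... | no _ | yes _ = refl
  ... | no _ | no ¬∃ = ⊥-elim (¬∃ (x , x∈M , e))

walk-avoiding : ∀ {G : Graph n} {C v y z} → TwoConnectedIn G C →
  v ∈ C → y ∈ C → z ∈ C → y ≢ v → z ≢ v → Walk G (_∈ C - v) y z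
walk-avoiding (_ , _ , C-v-connected) v∈C y∈C z∈C y≢v z≢v =
  fromPathIn (proj₂ (C-v-connected _ v∈C) _ _ (x∈p∧x≢y⇒x∈p-y y∈C y≢v) (x∈p∧x≢y⇒x∈p-y z∈C z≢v))

record CrossingEdge (G : Graph n) (C : Subset n) (x a : Fin n) : Set₁ where
  field
    {s w} : Fin n
    s∈C   : s ∈ C
    w∈C   : w ∈ C
    x∼s   : Edge G x s
    x≁w   : ¬ Edge G x w
    s∼w   : Edge G s w
    hub   : BranchSet G
    hub⊆C : ∀ {z} → member hub z → z ∈ C × z ≢ s × z ≢ w
    a∈hub : member hub a
    s∼hub : ∃[ u ] (member hub u × Edge G s u)
    w∼hub : ∃[ u ] (member hub u × Edge G w u)

-- Walk inside C − a from a neighbour of x to a non-neighbour; its first edge leaving N(x) is sw.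
-- Then 2-connectivity of C joins a to w avoiding s and to s avoiding w.
crossingEdge : ∀ {G : Graph n} {C x a s₀ c₀} → TwoConnectedIn G C →
  a ∈ C → s₀ ∈ C → c₀ ∈ C → s₀ ≢ a → Edge G x a → Edge G x s₀ → ¬ Edge G x c₀ → CrossingEdge G C x a
crossingEdge {G = G} {C} {x} {a} {s₀} {c₀} C-2conn a∈C s₀∈C c₀∈C s₀≢a x∼a x∼s₀ x≁c₀
  with exit (edge? G x) (walk-avoiding C-2conn a∈C s₀∈C c₀∈C s₀≢a λ { refl → x≁c₀ x∼a }) x∼s₀ x≁c₀
... | mkExit {s} {w} segment s∼w x≁w w∈C-a = record
  { s∈C = s∈C ; w∈C = w∈C ; x∼s = proj₂ (last∈ segment) ; x≁w = x≁w ; s∼w = s∼w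
  ; hub = walkSet hubWalk
  ; hub⊆C = onWalk⇒P hubWalk
  ; a∈hub = junction-onWalk (reverse j₁) j₂
  ; s∼hub = u₂ , last-onWalk hubWalk , Edge-sym G u₂∼s
  ; w∼hub = u₁ , head-onWalk hubWalk , Edge-sym G u₁∼w
  }
  where
  s∈C = proj₁ (x∈p-y⁻ (proj₁ (last∈ segment)))
  w∈C = proj₁ (x∈p-y⁻ w∈C-a)
  s≢a = proj₂ (x∈p-y⁻ (proj₁ (last∈ segment)))
  w≢a = proj₂ (x∈p-y⁻ w∈C-a)
  s≢w = Edge⇒≢ G s∼w
  toW = approach (walk-avoiding C-2conn s∈C a∈C w∈C (s≢a ∘ sym) (s≢w ∘ sym)) (w≢a ∘ sym)
  toS = approach (walk-avoiding C-2conn w∈C a∈C s∈C (w≢a ∘ sym) s≢w) (s≢a ∘ sym)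
  u₁ = proj₁ toW
  u₂ = proj₁ toS
  u₁∼w = proj₂ (proj₂ toW)
  u₂∼s = proj₂ (proj₂ toS)
  j₁ : Walk G (λ z → z ∈ C × z ≢ s × z ≢ w) a u₁
  j₁ = weaken (λ { (z∈C-s , z≢w) → proj₁ (x∈p-y⁻ z∈C-s) , proj₂ (x∈p-y⁻ z∈C-s) , z≢w })
              (proj₁ (proj₂ toW))
  j₂ : Walk G (λ z → z ∈ C × z ≢ s × z ≢ w) a u₂
  j₂ = weaken (λ { (z∈C-w , z≢s) → proj₁ (x∈p-y⁻ z∈C-w) , z≢s , proj₂ (x∈p-y⁻ z∈C-w) })
              (proj₁ (proj₂ toS))
  hubWalk = reverse j₁ ++ j₂

module Component {G : Graph n} {C M : Subset n} (M-comp : IsComponentOfMinus G C M)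
                 (∣A∣≤3 : ∣ NbhdSet G M ∩ C ∣ ≤ 3) where

  CNeighbour : Fin n → Pred (Fin n) 0ℓ
  CNeighbour x c = c ∈ C × Edge G x c

  Attached : Pred (Fin n) 0ℓ
  Attached x = ∃[ c ] CNeighbour x c

  attached? : Decidable Attached
  attached? x = any? λ c → (c ∈? C) ×-dec edge? G x c

  Detached : Pred (Fin n) 0ℓ
  Detached x = x ∈ M × ¬ Attached x

  detached? : Decidable Detached
  detached? x = (x ∈? M) ×-dec ¬? (attached? x)

  M≢C : x ∈ M → y ∈ C → x ≢ y
  M≢C x∈M y∈C refl = proj₁ M-comp _ x∈M y∈C

  CNeighbour⇒∈A : x ∈ M → CNeighbour x y → y ∈ NbhdSet G M ∩ C
  CNeighbour⇒∈A x∈M (y∈C , e) =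
    x∈p∩q⁺ (∈NbhdSet⁺ {G = G} x∈M (λ y∈M → M≢C y∈M y∈C refl) (Edge-sym G e) , y∈C)

  two-CNeighbours : ∣ Nbhd G x ∩ C ∣ ≢ 1 → Attached x → DistinctPair (CNeighbour x)
  two-CNeighbours ∣N∩C∣≢1 (c , c∈C , x∼c)
    with ∣p∣≢1⇒another (x∈p∩q⁺ (∈Nbhd⁺ {G = G} x∼c , c∈C)) ∣N∩C∣≢1
  ... | d , d∈N∩C , d≢c with x∈p∩q⁻ _ _ d∈N∩C
  ...   | d∈N , d∈C = d , c , d≢c , (d∈C , ∈Nbhd⁻ {G = G} d∈N) , (c∈C , x∼c)

  record Escape (P : Pred (Fin n) 0ℓ) (y : Fin n) : Set where
    field
      {last attachment} : Fin n
      walk          : Walk G (λ z → P z × Detached z) y last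
      edge          : Edge G last attachment
      attachment∈M  : attachment ∈ M
      attached      : Attached attachment
      attachment∈P  : P attachment

  escape : Walk G P y v → Detached y → v ∈ C → Escape P y
  escape r y-det v∈C with exit detached? r y-det (λ v-det → M≢C (proj₁ v-det) v∈C refl)
  ... | mkExit {outer = t} segment e ¬t-det t∈P = record
    { walk = segment ; edge = e ; attachment∈M = t∈M
    ; attached = decidable-stable (attached? t) (λ ¬att → ¬t-det (t∈M , ¬att))
    ; attachment∈P = t∈P
    }
    where
    s-det = proj₂ (last∈ segment)
    t∈M = proj₂ (proj₂ M-comp) _ _ (proj₁ s-det) e (λ t∈C → proj₂ s-det (t , t∈C , e))

  record DoubleEscape (y : Fin n) : Set where
    field
      {y₁ y₂ x₁ x₂} : Fin n
      walk          : Walk G Detached y y₂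
      y₁∈walk       : OnWalk walk y₁
      y₁∼x₁         : Edge G y₁ x₁
      y₂∼x₂         : Edge G y₂ x₂
      x₁∈M          : x₁ ∈ M
      x₂∈M          : x₂ ∈ M
      x₁-attached   : Attached x₁
      x₂-attached   : Attached x₂
      x₂≢x₁         : x₂ ≢ x₁

  doubleEscape : ∀ {c y} → TwoConnected G → c ∈ C → Detached y → DoubleEscape y
  doubleEscape {c} {y} (_ , G-connected , G-v-connected) c∈C y-det = record
    { walk = W₁ ++ W₂ ; y₁∈walk = junction-onWalk W₁ W₂ ; y₁∼x₁ = edge E₁ ; y₂∼x₂ = edge E₂
    ; x₁∈M = attachment∈M E₁ ; x₂∈M = attachment∈M E₂ ; x₁-attached = attached E₁ ; x₂-attached = attached E₂
    ; x₂≢x₁ = proj₂ (x∈p-y⁻ (attachment∈P E₂))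
    }
    where
    open Escape
    E₁ = escape (fromPathIn (proj₂ G-connected y c ∈⊤ ∈⊤)) y-det c∈C
    y₁-det = proj₂ (last∈ (walk E₁))
    y₁≢x₁ : last E₁ ≢ attachment E₁
    y₁≢x₁ eq = proj₂ y₁-det (subst Attached (sym eq) (attached E₁))
    c≢x₁ = M≢C (attachment∈M E₁) c∈C ∘ sym
    E₂ = escape (fromPathIn (proj₂ (G-v-connected (attachment E₁) ∈⊤) (last E₁) c
                              (x∈p∧x≢y⇒x∈p-y ∈⊤ y₁≢x₁) (x∈p∧x≢y⇒x∈p-y ∈⊤ c≢x₁)))
                y₁-det c∈C
    W₁ = weaken proj₂ (walk E₁)
    W₂ = weaken proj₂ (walk E₂)

  detached⇒gemModel : TwoConnected G → TwoConnectedIn G C → NbhdSet G M ∩ C ≢ C →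
    (∀ {x} → x ∈ M → ∣ Nbhd G x ∩ C ∣ ≢ 1) → Detached y → GemModel G
  detached⇒gemModel G-2conn C-2conn A≢C not-single y-det = record
    { X₀ = walkSet walk ; X₁ = singleton x₁ ; X₂ = singleton s ; X₃ = singleton w ; X₄ = adjoin hub x₂∼a a∈hub
    ; disj₀₁ = λ o → λ { refl → proj₂ (onWalk⇒P walk o) x₁-attached }
    ; disj₀₂ = λ o → λ { refl → M≢C (proj₁ (onWalk⇒P walk o)) s∈C refl }
    ; disj₀₃ = λ o → λ { refl → M≢C (proj₁ (onWalk⇒P walk o)) w∈C refl }
    ; disj₀₄ = λ o → λ { (inj₁ refl) → proj₂ (onWalk⇒P walk o) x₂-attached
                       ; (inj₂ h) → M≢C (proj₁ (onWalk⇒P walk o)) (proj₁ (hub⊆C h)) refl }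
    ; disj₁₂ = singleton-disjoint {G = G} (M≢C x₁∈M s∈C)
    ; disj₁₃ = singleton-disjoint {G = G} (M≢C x₁∈M w∈C)
    ; disj₁₄ = λ { refl (inj₁ x₁≡x₂) → x₂≢x₁ (sym x₁≡x₂)
                 ; refl (inj₂ h) → M≢C x₁∈M (proj₁ (hub⊆C h)) refl }
    ; disj₂₃ = singleton-disjoint {G = G} (Edge⇒≢ G s∼w)
    ; disj₂₄ = λ { refl (inj₁ s≡x₂) → M≢C x₂∈M s∈C (sym s≡x₂)
                 ; refl (inj₂ h) → proj₁ (proj₂ (hub⊆C h)) refl }
    ; disj₃₄ = λ { refl (inj₁ w≡x₂) → M≢C x₂∈M w∈C (sym w≡x₂)
                 ; refl (inj₂ h) → proj₂ (proj₂ (hub⊆C h)) refl }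
    ; touch₀₁ = _ , _ , y₁∈walk , refl , y₁∼x₁
    ; touch₁₂ = singleton-touching {G = G} x∼s
    ; touch₂₃ = singleton-touching {G = G} s∼w
    ; touch₀₄ = _ , _ , last-onWalk walk , inj₁ refl , y₂∼x₂
    ; touch₁₄ = _ , _ , refl , inj₂ a∈hub , x₁∼a
    ; touch₂₄ = _ , _ , refl , inj₂ (proj₁ (proj₂ s∼hub)) , proj₂ (proj₂ s∼hub)
    ; touch₃₄ = _ , _ , refl , inj₂ (proj₁ (proj₂ w∼hub)) , proj₂ (proj₂ w∼hub)
    ; apart₀₂ = λ o → λ { refl e → proj₂ (onWalk⇒P walk o) (s , s∈C , e) }
    ; apart₀₃ = λ o → λ { refl e → proj₂ (onWalk⇒P walk o) (w , w∈C , e) }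
    ; apart₁₃ = λ { refl refl → x≁w }
    }
    where
    open DoubleEscape (doubleEscape G-2conn (proj₂ (proj₁ (proj₁ (proj₂ C-2conn)))) y-det)
    pair₁ = two-CNeighbours (not-single x₁∈M) x₁-attached
    common = pairs-meet ∣A∣≤3 (CNeighbour⇒∈A x₁∈M) (CNeighbour⇒∈A x₂∈M) pair₁
                        (two-CNeighbours (not-single x₂∈M) x₂-attached)
    a = proj₁ common
    x₁∼a = proj₂ (proj₁ (proj₂ common))
    x₂∼a = proj₂ (proj₂ (proj₂ common))
    s₀ = avoiding pair₁ a
    c₀ = ⊆∧≢⇒∃∉ (p∩q⊆q _ _) A≢C
    x₁≁c₀ : ¬ Edge G x₁ (proj₁ c₀)
    x₁≁c₀ e = proj₂ (proj₂ c₀) (CNeighbour⇒∈A x₁∈M (proj₁ (proj₂ c₀) , e))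
    open CrossingEdge (crossingEdge C-2conn (proj₁ (proj₁ (proj₂ common))) (proj₁ (proj₁ (proj₂ s₀)))
                                    (proj₁ (proj₂ c₀)) (proj₂ (proj₂ s₀)) x₁∼a (proj₂ (proj₁ (proj₂ s₀))) x₁≁c₀)

  every-vertex-attached : GemInducedMinorFree G → TwoConnected G → TwoConnectedIn G C → NbhdSet G M ∩ C ≢ C →
    (∀ {x} → x ∈ M → ∣ Nbhd G x ∩ C ∣ ≢ 1) → ∀ x → x ∈ M → Attached x
  every-vertex-attached gemFree G-2conn C-2conn A≢C not-single x x∈M =
    decidable-stable (attached? x) λ ¬att →
      gemFree (gemModel⇒≼ (detached⇒gemModel G-2conn C-2conn A≢C not-single (x∈M , ¬att)))

  P4Free : GemInducedMinorFree G → ConnectedIn G C → (∀ {x} → x ∈ M → DistinctPair (CNeighbour x)) → P4FreeIn G M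
  P4Free gemFree C-connected two a b c d a∈M b∈M c∈M d∈M
         a≢b a≢c a≢d b≢c b≢d c≢d a∼b b∼c c∼d a≁c b≁d a≁d =
    gemFree (gemModel⇒≼ record
      { X₀ = singleton a ; X₁ = singleton b ; X₂ = singleton c ; X₃ = singleton d ; X₄ = walkSet J
      ; disj₀₁ = singleton-disjoint {G = G} a≢b
      ; disj₀₂ = singleton-disjoint {G = G} a≢c
      ; disj₀₃ = singleton-disjoint {G = G} a≢d
      ; disj₀₄ = off-hub a∈M
      ; disj₁₂ = singleton-disjoint {G = G} b≢c
      ; disj₁₃ = singleton-disjoint {G = G} b≢d
      ; disj₁₄ = off-hub b∈M
      ; disj₂₃ = singleton-disjoint {G = G} c≢d
      ; disj₂₄ = off-hub c∈M
      ; disj₃₄ = off-hub d∈M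
      ; touch₀₁ = singleton-touching {G = G} a∼b
      ; touch₁₂ = singleton-touching {G = G} b∼c
      ; touch₂₃ = singleton-touching {G = G} c∼d
      ; touch₀₄ = sees-hub a∈M
      ; touch₁₄ = sees-hub b∈M
      ; touch₂₄ = sees-hub c∈M
      ; touch₃₄ = sees-hub d∈M
      ; apart₀₂ = singleton-apart {G = G} a≁c
      ; apart₀₃ = singleton-apart {G = G} a≁d
      ; apart₁₃ = singleton-apart {G = G} b≁d
      })
    where
    pair = two a∈M
    c₁ = proj₁ pair
    c₂ = proj₁ (proj₂ pair)
    a∼c₁ = proj₁ (proj₂ (proj₂ (proj₂ pair)))
    a∼c₂ = proj₂ (proj₂ (proj₂ (proj₂ pair)))
    J = fromPathIn (proj₂ C-connected c₁ c₂ (proj₁ a∼c₁) (proj₁ a∼c₂))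

    off-hub : x ∈ M → Disjoint (singleton x) (walkSet J)
    off-hub x∈M refl o = M≢C x∈M (onWalk⇒P J o) refl

    ends⊆A : ∀ {z} → z ≡ c₁ ⊎ z ≡ c₂ → z ∈ NbhdSet G M ∩ C
    ends⊆A (inj₁ refl) = CNeighbour⇒∈A a∈M a∼c₁
    ends⊆A (inj₂ refl) = CNeighbour⇒∈A a∈M a∼c₂

    sees-hub : x ∈ M → Touching (singleton x) (walkSet J)
    sees-hub x∈M with pairs-meet ∣A∣≤3 (CNeighbour⇒∈A x∈M) ends⊆A (two x∈M)
                                 (c₁ , c₂ , proj₁ (proj₂ (proj₂ pair)) , inj₁ refl , inj₂ refl)
    ... | _ , (_ , e) , inj₁ refl = _ , _ , refl , head-onWalk J , e
    ... | _ , (_ , e) , inj₂ refl = _ , _ , refl , last-onWalk J , e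

mainTheorem12 : {n : ℕ} (G : Graph n) (C M : Subset n) →
    TwoConnected G → GemInducedMinorFree G →
    TwoConnectedIn G C →
    IsComponentOfMinus G C M →
    NbhdSet G M ∩ C ≢ C →
    ∣ NbhdSet G M ∩ C ∣ ≤ 3 →
    ¬ (∃[ x ] (x ∈ M × ∣ Nbhd G x ∩ C ∣ ≡ 1)) →
    (∀ x → x ∈ M → ∃[ c ] (c ∈ C × Edge G x c)) × P4FreeIn G M
mainTheorem12 G C M G-2conn gemFree C-2conn M-comp A≢C ∣A∣≤3 no-single =
  attached , P4Free gemFree (proj₁ (proj₂ C-2conn)) λ x∈M → two-CNeighbours (not-single x∈M) (attached _ x∈M)
  where
  open Component M-comp ∣A∣≤3
  not-single : ∀ {x} → x ∈ M → ∣ Nbhd G x ∩ C ∣ ≢ 1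
  not-single x∈M ∣N∩C∣≡1 = no-single (_ , x∈M , ∣N∩C∣≡1)
  attached : ∀ x → x ∈ M → Attached x
  attached = every-vertex-attached gemFree G-2conn C-2conn A≢C not-single
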